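{- Assume (G5): for every object $U$ of $\mathbf C$, every arrow in $\Sigma(U)$ is monic. Then for every cover $f$, the degree of any Galois closure of $f$ divides $(\deg f)!$.
   Context: Let $\mathbf C$ be a category and $\mathbf D$ a full subcategory of $\mathbf C$. For arrows $f,g$ of $\mathbf C$ with ${\rm cod}\,f={\rm cod}\,g$, ${\rm Hom}(g,f)$ denotes the collection of all arrows $h$ of $\mathbf C$ with $g=f\circ h$. Standing assumptions: (G1) every diagram $B\to A\leftarrow C$ in $\mathbf D$ has a pullback in $\mathbf C$. (G2) (I) pushouts exist in $\mathbf D$; (II) every arrow of $\mathbf D$ is epic; (III) every monic arrow of $\mathbf D$ is an isomorphism whose inverse is an arrow of $\mathbf D$. (G3) for every object $U$ of $\mathbf C$ there is a set $\Sigma(U)$ of arrows $i$ of $\mathbf C$ with ${\rm dom}\,i$ in $\mathbf D$ and ${\rm cod}\,i=U$ such that for every arrow $u$ of $\mathbf C$ with ${\rm dom}\,u$ in $\mathbf D$ and ${\rm cod}\,u=U$ there is exactly one $i\in\Sigma(U)$ with ${\rm Hom}(u,i)\neq\emptyset$. (G4) there is a function $\deg$ from the collection of arrows of $\mathbf C$ whose codomain lies in $\mathbf D$ to the positive integers such that (I) $\deg(g\circ f)=\deg g\cdot\deg f$ whenever $f,g,g\circ f$ all lie in this collection; (II) $\deg f=\sum_{i\in\Sigma({\rm dom}\,f)}\deg(f\circ i)$ for every such $f$; (III) if $B\xrightarrow{f}A\xleftarrow{g}C$ is a diagram in $\mathbf D$ with pullback $B\xleftarrow{p}U\xrightarrow{q}C$,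 then $\deg f=\deg q$ and $\deg g=\deg p$. A cover is an arrow of $\mathbf D$. For a cover $f$, ${\rm Aut}(f)$ is the set of isomorphisms in ${\rm Hom}(f,f)$; $f$ is Galois if $|{\rm Aut}(f)|=\deg f$. Write $f\sqsubseteq g$ if ${\rm cod}\,f={\rm cod}\,g$ and ${\rm Hom}(g,f)\neq\emptyset$. A Galois closure of a cover $f$ is a cover $g$ which is Galois with $f\sqsubseteq g$ and such that $g\sqsubseteq h$ for every Galois cover $h$ with $f\sqsubseteq h\sqsubseteq g$. -}

module Defs where

open import Level using (Level; _⊔_; suc)
open import Data.Nat using (ℕ; _>_; zero)
open import Data.Fin using (Fin)
open import Data.List using (List; map)
open import Data.Nat.ListAction using (sum)
open import Data.List.Membership.Propositional using (_∈_)
open import Data.List.Relation.Unary.Unique.Propositional using (Unique)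
open import Data.Product using (Σ; Σ-syntax; ∃; ∃-syntax; _×_; _,_)
open import Relation.Binary.PropositionalEquality using (_≡_)
open import Function.Bundles using (_↔_)

record Category (o ℓ : Level) : Set (Level.suc (o ⊔ ℓ)) where
  infixr 9 _∘_
  field
    Obj    : Set o
    Hom    : Obj → Obj → Set ℓ
    id     : ∀ {A} → Hom A A
    _∘_    : ∀ {A B C} → Hom B C → Hom A B → Hom A C
    identityˡ : ∀ {A B} (f : Hom A B) → id ∘ f ≡ f
    identityʳ : ∀ {A B} (f : Hom A B) → f ∘ id ≡ f
    assoc  : ∀ {A B C E} (f : Hom A B) (g : Hom B C) (h : Hom C E) →
             (h ∘ g) ∘ f ≡ h ∘ (g ∘ f)
    Hom-isSet : ∀ {A B} {f g : Hom A B} (p q : f ≡ g) → p ≡ q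

module CatNotions {o ℓ : Level} (C : Category o ℓ) where
  open Category C

  Monic : ∀ {A B} → Hom A B → Set (o ⊔ ℓ)
  Monic {A} f = ∀ {X} (g h : Hom X A) → f ∘ g ≡ f ∘ h → g ≡ h

  IsIso : ∀ {A B} → Hom A B → Set ℓ
  IsIso {A} {B} f = Σ[ g ∈ Hom B A ] (g ∘ f ≡ id × f ∘ g ≡ id)

  -- Hom(g , f) = { h | g = f ∘ h }   (cod f = cod g)
  HomOver : ∀ {A B E} → Hom E A → Hom B A → Set ℓ
  HomOver {A} {B} {E} g f = Σ[ h ∈ Hom E B ] (g ≡ f ∘ h)

  record IsPullback {A B E : Obj} (f : Hom B A) (g : Hom E A)
                    {P : Obj} (p : Hom P B) (q : Hom P E) : Set (o ⊔ ℓ) where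
    field
      commute   : f ∘ p ≡ g ∘ q
      universal : ∀ {X} (x : Hom X B) (y : Hom X E) → f ∘ x ≡ g ∘ y →
                  Σ[ u ∈ Hom X P ] ((p ∘ u ≡ x × q ∘ u ≡ y) ×
                    (∀ (u' : Hom X P) → p ∘ u' ≡ x → q ∘ u' ≡ y → u' ≡ u))

  record Pullback {A B E : Obj} (f : Hom B A) (g : Hom E A) : Set (o ⊔ ℓ) where
    field
      P  : Obj
      p  : Hom P B
      q  : Hom P E
      isPullback : IsPullback f g p q

-- The standing assumptions (G1)–(G4) for a category C and a full
-- subcategory D of C (given by a proof-irrelevant predicate on objects).

record GaloisSetting {o ℓ : Level} (d s : Level) (C : Category o ℓ)
       : Set (Level.suc (o ⊔ ℓ ⊔ d ⊔ s)) where
  open Category C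
  open CatNotions C
  field
    D       : Obj → Set d
    D-prop  : ∀ {A} (a b : D A) → a ≡ b

    G1 : ∀ {A B E} → D A → D B → D E → (f : Hom B A) (g : Hom E A) → Pullback f g

    G2-I : ∀ {A E F} → D A → D E → D F → (f : Hom A E) (g : Hom A F) →
           Σ[ Q ∈ Obj ] Σ[ dQ ∈ D Q ] Σ[ i ∈ Hom E Q ] Σ[ j ∈ Hom F Q ]
             (i ∘ f ≡ j ∘ g ×
              (∀ {X} → D X → (x : Hom E X) (y : Hom F X) → x ∘ f ≡ y ∘ g →
                 Σ[ u ∈ Hom Q X ] ((u ∘ i ≡ x × u ∘ j ≡ y) ×
                   (∀ (u' : Hom Q X) → u' ∘ i ≡ x → u' ∘ j ≡ y → u' ≡ u))))

    G2-II : ∀ {A B} → D A → D B → (f : Hom A B) →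
            ∀ {X} → D X → (g h : Hom B X) → g ∘ f ≡ h ∘ f → g ≡ h

    -- (G2)(III) every monic arrow of D (monic in D) is an isomorphism
    -- (its inverse is then automatically an arrow of D, D being full)
    G2-III : ∀ {A B} → D A → D B → (f : Hom A B) →
             (∀ {X} → D X → (g h : Hom X A) → f ∘ g ≡ f ∘ h → g ≡ h) →
             IsIso f

    -- (G3) the sets Σ(U), given as indexed families of arrows into U
    Σidx   : Obj → Set s
    Σdom   : ∀ {U} → Σidx U → Obj
    Σdom-D : ∀ {U} (k : Σidx U) → D (Σdom k)
    Σarr   : ∀ {U} (k : Σidx U) → Hom (Σdom k) U
    G3 : ∀ {U X} → D X → (u : Hom X U) →
         Σ[ k ∈ Σidx U ] (HomOver u (Σarr k) ×
           (∀ (k' : Σidx U) → HomOver u (Σarr k') → k' ≡ k))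

    deg     : ∀ {X A} → D A → Hom X A → ℕ
    deg-pos : ∀ {X A} (a : D A) (f : Hom X A) → deg a f > zero
    G4-I : ∀ {X Y A} (a : D A) (y : D Y) (f : Hom X Y) (g : Hom Y A) →
           deg a (g ∘ f) ≡ Data.Nat._*_ (deg a g) (deg y f)
    -- (II) deg f = Σ_{i ∈ Σ(dom f)} deg (f ∘ i); the (necessarily finite)
    -- index set is enumerated without repetition by a list
    G4-II : ∀ {U A} (a : D A) (f : Hom U A) →
            Σ[ ks ∈ List (Σidx U) ]
              (Unique ks × (∀ k → k ∈ ks) ×
               deg a f ≡ sum (map (λ k → deg a (f ∘ Σarr k)) ks))
    G4-III : ∀ {A B E} (a : D A) (b : D B) (e : D E) (f : Hom B A) (g : Hom E A)
             {P : Obj} (p : Hom P B) (q : Hom P E) → IsPullback f g p q →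
             deg a f ≡ deg e q × deg a g ≡ deg b p

module GaloisNotions {o ℓ d s : Level} {C : Category o ℓ}
                     (S : GaloisSetting d s C) where
  open Category C
  open CatNotions C
  open GaloisSetting S

  G5 : Set (o ⊔ ℓ ⊔ s)
  G5 = ∀ {U} (k : Σidx U) → Monic (Σarr k)

  record Cover (A : Obj) : Set (o ⊔ ℓ ⊔ d) where
    constructor cover
    field
      {dom}  : Obj
      domD   : D dom
      codD   : D A
      arr    : Hom dom A

  degC : ∀ {A} → Cover A → ℕ
  degC c = deg (Cover.codD c) (Cover.arr c)

  Aut : ∀ {A} → Cover A → Set ℓ
  Aut c = Σ[ h ∈ HomOver (Cover.arr c) (Cover.arr c) ] IsIso (Data.Product.proj₁ h)

  Galois : ∀ {A} → Cover A → Set ℓ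
  Galois c = Fin (degC c) ↔ Aut c

  _⊑_ : ∀ {A} → Cover A → Cover A → Set ℓ
  f ⊑ g = HomOver (Cover.arr g) (Cover.arr f)

  IsGaloisClosure : ∀ {A} → Cover A → Cover A → Set (o ⊔ ℓ ⊔ d)
  IsGaloisClosure f g =
    Galois g × f ⊑ g × (∀ (h : Cover _) → Galois h → f ⊑ h → h ⊑ g → g ⊑ h)

{-# OPTIONS --safe #-}
-- Let g : E → A be a Galois closure of f : B → A and h₀ : E → B a lift of g through f. The group
-- G = Aut g acts on the lifts of g through f by precomposition, and there are at most deg f of
-- them; so it suffices that G acts faithfully on the orbit of h₀, because a group acting
-- faithfully on n points acts freely on the n! Lehmer codes of their permutations.
-- For faithfulness, let v : E → K be the joint image of the lifts h₀ ∘ σ in the fibre power of B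
-- over A (iterated pullbacks, cut down to one Σ-component each time, which G5 keeps monic).
-- Automorphisms of g descend along v through pushouts, and counting lifts with
-- deg g = deg (K → A) · deg v shows that K → A is Galois. It lies between f and g, so by
-- minimality g factors through it and v is split monic: an automorphism fixing every h₀ ∘ σ
-- fixes v and is therefore trivial.

module Submission where

open import Defs
open import Level using (Level; _⊔_)
open import Algebra.Core using (Op₁; Op₂)
open import Algebra.Bundles using (Group)
open import Algebra.Structures using (IsGroup)
import Algebra.Properties.Group as GroupProperties
open import Axiom.UniquenessOfIdentityProofs using (module Decidable⇒UIP)
open import Data.Fin as Fin using (Fin; zero; suc; punchIn; punchOut)
import Data.Fin.Properties as Fin
open import Data.List using (List; []; _∷_; map; length; lookup; allFin)
open import Data.List.Membership.Propositional using (_∈_)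
open import Data.List.Membership.Propositional.Properties using (∈-map⁺; ∈-allFin)
import Data.List.Relation.Unary.All as All
import Data.List.Relation.Unary.All.Properties as All
import Data.List.Relation.Unary.Any as Any
import Data.List.Relation.Unary.Any.Properties as Any
open import Data.Nat as ℕ using (ℕ; zero; suc; _+_; _*_; _!; _≤_; _<_)
import Data.Nat.Properties as ℕ
open import Data.Nat.ListAction using (sum)
open import Data.Nat.Divisibility using (_∣_; divides)
open import Data.Product using (Σ; Σ-syntax; ∃; _×_; _,_; proj₁; proj₂)
open import Data.Product.Function.NonDependent.Propositional using (_×-↔_)
open import Data.Sum using (_⊎_; inj₁; inj₂)
open import Data.Sum.Function.Propositional using (_⊎-↔_)
open import Data.Unit using (⊤; tt)
open import Function using (_∘′_; Injective)
open import Function.Bundles using (_↔_; _↣_; mk↔ₛ′; mk↣; Inverse; Injection)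
open import Function.Properties.Inverse using (↔-refl; ↔-sym; ↔-trans; ↔⇒↣)
open import Function.Properties.Injection using (↣-trans)
open import Relation.Binary.PropositionalEquality
open import Relation.Nullary using (Dec; yes; no; ¬_; contradiction)
import Relation.Nullary as Nullary
open import Relation.Unary using (Pred; Decidable; Irrelevant)

private
  variable
    a b ℓ′ : Level
    S : Set a
    T : Set b
    m n : ℕ

injective⇒surjective : (f : Fin m → Fin n) → Injective _≡_ _≡_ f → n ≤ m →
                       ∀ y → ∃ λ x → f x ≡ y
injective⇒surjective {n = suc n} f f-inj n≤m y with Fin.any? (λ x → f x Fin.≟ y)
... | yes hit = hit
... | no miss = contradiction (Fin.injective⇒≤ punchOut-f-injective) (ℕ.<⇒≱ n≤m)
  where
  y≢f : ∀ x → y ≢ f x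
  y≢f x eq = miss (x , sym eq)
  punchOut-f-injective : Injective _≡_ _≡_ (λ x → punchOut (y≢f x))
  punchOut-f-injective eq = f-inj (Fin.punchOut-injective (y≢f _) (y≢f _) eq)

↔-injective : (e : S ↔ T) → Injective _≡_ _≡_ (Inverse.to e)
↔-injective e = Injection.injective (↔⇒↣ e)

Fin-injective : Fin m ↔ Fin n → m ≡ n
Fin-injective e = Fin.cantor-schröder-bernstein (↔-injective e) (↔-injective (↔-sym e))

Dec-irrelevant↔Fin : Dec S → Nullary.Irrelevant S → ∃ λ k → S ↔ Fin k
Dec-irrelevant↔Fin (yes x) S-irr =
  1 , mk↔ₛ′ (λ _ → zero) (λ _ → x) (λ { zero → refl }) (S-irr x)
Dec-irrelevant↔Fin (no ¬x) _ =
  0 , mk↔ₛ′ (λ x → contradiction x ¬x) (λ ()) (λ ()) (λ x → contradiction x ¬x)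

Σ-Fin-suc↔ : {P : Pred (Fin (suc n)) ℓ′} → Σ (Fin (suc n)) P ↔ (P zero ⊎ Σ (Fin n) (P ∘′ suc))
Σ-Fin-suc↔ = mk↔ₛ′ split join (λ { (inj₁ _) → refl ; (inj₂ _) → refl })
                               (λ { (zero , _) → refl ; (suc _ , _) → refl })
  where
  split : Σ (Fin _) _ → _ ⊎ _
  split (zero , x) = inj₁ x
  split (suc i , x) = inj₂ (i , x)
  join : _ ⊎ _ → Σ (Fin _) _
  join (inj₁ x) = zero , x
  join (inj₂ (i , x)) = suc i , x

decidableSubset↔Fin : {P : Pred (Fin n) ℓ′} → Decidable P → Irrelevant P →
                      ∃ λ k → Σ (Fin n) P ↔ Fin k
decidableSubset↔Fin {n = zero} _ _ = 0 , mk↔ₛ′ (λ ()) (λ ()) (λ ()) (λ ())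
decidableSubset↔Fin {n = suc n} P? P-irr =
  let k₀ , e₀ = Dec-irrelevant↔Fin (P? zero) P-irr
      k , e = decidableSubset↔Fin (λ i → P? (suc i)) P-irr
  in k₀ + k , ↔-trans Σ-Fin-suc↔ (↔-trans (e₀ ⊎-↔ e) (↔-sym Fin.+↔⊎))

Fin-UIP : ∀ {x y : Fin n} (p q : x ≡ y) → p ≡ q
Fin-UIP = Decidable⇒UIP.≡-irrelevant Fin._≟_

length≤sum : ∀ {X : Set a} (w : X → ℕ) → (∀ x → 0 < w x) → ∀ xs → length xs ≤ sum (map w xs)
length≤sum w w>0 [] = ℕ.z≤n
length≤sum w w>0 (x ∷ xs) = ℕ.+-mono-≤ (w>0 x) (length≤sum w w>0 xs)

module _ {A : Set a} (enum : Fin m ↔ A) {L₁ L₂ : ℕ} (φ : A → Fin L₁)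
         (δ : ∀ a₀ a → φ a₀ ≡ φ a → Fin L₂)
         (δ-injective : ∀ a₀ {a a′} p p′ → δ a₀ a p ≡ δ a₀ a′ p′ → a ≡ a′) where

  open Inverse enum using (to; from; strictlyInverseˡ)

  private
    search : ∀ y → Dec (∃ λ i → φ (to i) ≡ y)
    search y = Fin.any? (λ i → φ (to i) Fin.≟ y)

    offset : ∀ y → Dec (∃ λ i → φ (to i) ≡ y) → (a : A) → φ a ≡ y → Fin L₂
    offset y (yes (i , φi≡y)) a φa≡y = δ (to i) a (trans φi≡y (sym φa≡y))
    offset y (no ¬hit) a φa≡y =
      contradiction (from a , trans (cong φ (strictlyInverseˡ a)) φa≡y) ¬hit

    offset-injective : ∀ {y y′} → y ≡ y′ → ∀ {a a′} (p : φ a ≡ y) (p′ : φ a′ ≡ y′) →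
                       offset y (search y) a p ≡ offset y′ (search y′) a′ p′ → a ≡ a′
    offset-injective {y} refl p p′ eq with search y
    ... | yes (i , _) = δ-injective (to i) _ _ eq
    ... | no ¬hit = contradiction (from _ , trans (cong φ (strictlyInverseˡ _)) p) ¬hit

    coordinates : Fin m → Fin (L₁ * L₂)
    coordinates i =
      Inverse.from Fin.*↔× (φ (to i) , offset (φ (to i)) (search (φ (to i))) (to i) refl)

    coordinates-injective : Injective _≡_ _≡_ coordinates
    coordinates-injective eq =
      let eq′ = ↔-injective (↔-sym Fin.*↔×) eq
      in ↔-injective enum (offset-injective (cong proj₁ eq′) refl refl (cong proj₂ eq′))

  L₁*L₂≤card⇒surjective : L₁ * L₂ ≤ m → A → ∀ y → ∃ λ a → φ a ≡ y
  L₁*L₂≤card⇒surjective L₁*L₂≤m a₀ y =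
    let i , eq = injective⇒surjective coordinates coordinates-injective L₁*L₂≤m
                   (Inverse.from Fin.*↔× (y , δ a₀ a₀ refl))
    in to i , cong proj₁ (↔-injective (↔-sym Fin.*↔×) eq)

Lehmer : ℕ → Set
Lehmer zero = ⊤
Lehmer (suc n) = Fin (suc n) × Lehmer n

Lehmer↔Fin! : ∀ n → Lehmer n ↔ Fin (n !)
Lehmer↔Fin! zero = mk↔ₛ′ (λ _ → zero) (λ _ → tt) (λ { zero → refl }) (λ _ → refl)
Lehmer↔Fin! (suc n) = ↔-trans (↔-refl ×-↔ Lehmer↔Fin! n) (↔-sym Fin.*↔×)

decode : Lehmer n → Fin n → Fin n
decode {suc n} (x , c) zero = x
decode {suc n} (x , c) (suc i) = punchIn x (decode c i)

decode-injective : (c : Lehmer n) → Injective _≡_ _≡_ (decode c)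
decode-injective {suc n} (x , c) {zero} {zero} _ = refl
decode-injective {suc n} (x , c) {zero} {suc j} eq = contradiction (sym eq) (Fin.punchInᵢ≢i x _)
decode-injective {suc n} (x , c) {suc i} {zero} eq = contradiction eq (Fin.punchInᵢ≢i x _)
decode-injective {suc n} (x , c) {suc i} {suc j} eq =
  cong suc (decode-injective c (Fin.punchIn-injective x _ _ eq))

decode-extensional : (c c′ : Lehmer n) → (∀ i → decode c i ≡ decode c′ i) → c ≡ c′
decode-extensional {zero} tt tt _ = refl
decode-extensional {suc n} (x , c) (x′ , c′) eq with eq zero
... | refl = cong (x ,_) (decode-extensional c c′ (λ i → Fin.punchIn-injective x _ _ (eq (suc i))))

encode : (f : Fin n → Fin n) → Injective _≡_ _≡_ f → Lehmer n
encode {zero} _ _ = tt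
encode {suc n} f f-inj = f zero , encode tail tail-injective
  where
  f₀≢f : ∀ i → f zero ≢ f (suc i)
  f₀≢f i eq with () ← f-inj eq
  tail : Fin n → Fin n
  tail i = punchOut (f₀≢f i)
  tail-injective : Injective _≡_ _≡_ tail
  tail-injective eq = Fin.suc-injective (f-inj (Fin.punchOut-injective (f₀≢f _) (f₀≢f _) eq))

decode-encode : (f : Fin n → Fin n) (f-inj : Injective _≡_ _≡_ f) →
                ∀ i → decode (encode f f-inj) i ≡ f i
decode-encode {suc n} f f-inj zero = refl
decode-encode {suc n} f f-inj (suc i) =
  trans (cong (punchIn (f zero)) (decode-encode _ _ i)) (Fin.punchIn-punchOut _)

module _ {G : Set a} {_∙_ : Op₂ G} {ε : G} {_⁻¹ : Op₁ G}
         (isGroup : IsGroup _≡_ _∙_ ε _⁻¹) where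

  open IsGroup isGroup using (assoc; identityʳ; inverseʳ)
  private
    group : Group a a
    group = record { isGroup = isGroup }

  open GroupProperties group using (x∙y⁻¹≈ε⇒x≈y)

  record IsRightAction {X : Set b} (_◃_ : X → G → X) : Set (a ⊔ b) where
    field
      ◃-∙ : ∀ x σ ρ → x ◃ (σ ∙ ρ) ≡ (x ◃ σ) ◃ ρ
      ◃-ε : ∀ x → x ◃ ε ≡ x

    ◃-⁻¹ : ∀ x σ → (x ◃ σ) ◃ (σ ⁻¹) ≡ x
    ◃-⁻¹ x σ = begin
      (x ◃ σ) ◃ (σ ⁻¹)  ≡⟨ ◃-∙ x σ (σ ⁻¹) ⟨
      x ◃ (σ ∙ (σ ⁻¹))  ≡⟨ cong (x ◃_) (inverseʳ σ) ⟩
      x ◃ ε             ≡⟨ ◃-ε x ⟩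
      x                 ∎
      where open ≡-Reasoning

  module _ (enum : Fin m ↔ G) {N : ℕ} {_◃_ : Fin N → G → Fin N}
           (isAction : IsRightAction _◃_)
           (free : ∀ x σ ρ → x ◃ σ ≡ x ◃ ρ → σ ≡ ρ) where

    open IsRightAction isAction
    open import Data.List.Extrema (Fin.≤-totalOrder N) using (min; min≤xs; argmin-all)

    private
      elements : List G
      elements = map (Inverse.to enum) (allFin m)

      ∈-elements : ∀ σ → σ ∈ elements
      ∈-elements σ = subst (_∈ elements) (Inverse.strictlyInverseˡ enum σ)
                           (∈-map⁺ (Inverse.to enum) (∈-allFin _))

      InOrbit : Fin N → Fin N → Set a
      InOrbit x y = ∃ λ σ → x ◃ σ ≡ y

      rep : Fin N → Fin N
      rep x = min x (map (x ◃_) elements)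

      rep-≤ : ∀ x {y} → InOrbit x y → rep x Fin.≤ y
      rep-≤ x (σ , refl) = All.lookup (min≤xs x _) (∈-map⁺ (x ◃_) (∈-elements σ))

      rep-∈ : ∀ x → InOrbit x (rep x)
      rep-∈ x = argmin-all (λ y → y) {P = InOrbit x} (ε , ◃-ε x)
                  (All.map⁺ (All.universal (λ σ → σ , refl) elements))

      rep-◃ : ∀ x σ → rep (x ◃ σ) ≡ rep x
      rep-◃ x σ = Fin.≤-antisym (rep-≤ (x ◃ σ) ((σ ⁻¹) ∙ τ , back)) (rep-≤ x (σ ∙ τ′ , forth))
        where
        open ≡-Reasoning
        τ = proj₁ (rep-∈ x)
        τ′ = proj₁ (rep-∈ (x ◃ σ))
        back : (x ◃ σ) ◃ ((σ ⁻¹) ∙ τ) ≡ rep x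
        back = begin
          (x ◃ σ) ◃ ((σ ⁻¹) ∙ τ)  ≡⟨ ◃-∙ (x ◃ σ) (σ ⁻¹) τ ⟩
          ((x ◃ σ) ◃ (σ ⁻¹)) ◃ τ  ≡⟨ cong (_◃ τ) (◃-⁻¹ x σ) ⟩
          x ◃ τ                 ≡⟨ proj₂ (rep-∈ x) ⟩
          rep x                 ∎
        forth : x ◃ (σ ∙ τ′) ≡ rep (x ◃ σ)
        forth = trans (◃-∙ x σ τ′) (proj₂ (rep-∈ (x ◃ σ)))

      Reps : Set
      Reps = Σ (Fin N) (λ y → rep y ≡ y)

      Reps-≡ : {u v : Reps} → proj₁ u ≡ proj₁ v → u ≡ v
      Reps-≡ {y , q} {.y , q′} refl = cong (y ,_) (Fin-UIP q q′)

      rep-idem : ∀ x → rep (rep x) ≡ rep x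
      rep-idem x = trans (cong rep (sym (proj₂ (rep-∈ x)))) (rep-◃ x (proj₁ (rep-∈ x)))

      shift : ∀ x → ∃ λ σ → rep x ◃ σ ≡ x
      shift x = let τ , xτ≡rep = rep-∈ x in
        (τ ⁻¹) , trans (cong (_◃ (τ ⁻¹)) (sym xτ≡rep)) (◃-⁻¹ x τ)

      orbitDecomposition : Fin N ↔ (G × Reps)
      orbitDecomposition = mk↔ₛ′ split (λ (σ , y , _) → y ◃ σ) split∘join (λ x → proj₂ (shift x))
        where
        split : Fin N → G × Reps
        split x = proj₁ (shift x) , rep x , rep-idem x
        split∘join : ∀ s → split (proj₁ (proj₂ s) ◃ proj₁ s) ≡ s
        split∘join (σ , y , rep-y) = cong₂ _,_ (free y _ σ shifted) (Reps-≡ rep-yσ)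
          where
          rep-yσ : rep (y ◃ σ) ≡ y
          rep-yσ = trans (rep-◃ y σ) rep-y
          shifted : y ◃ proj₁ (shift (y ◃ σ)) ≡ y ◃ σ
          shifted = subst (λ z → z ◃ proj₁ (shift (y ◃ σ)) ≡ y ◃ σ) rep-yσ (proj₂ (shift (y ◃ σ)))

    free⇒order∣size : m ∣ N
    free⇒order∣size = divides k (trans (Fin-injective N↔m*k) (ℕ.*-comm m k))
      where
      Reps-finite : ∃ λ k → Reps ↔ Fin k
      Reps-finite = decidableSubset↔Fin (λ y → rep y Fin.≟ y) (λ {y} → Fin-UIP)
      k : ℕ
      k = proj₁ Reps-finite
      N↔m*k : Fin N ↔ Fin (m * k)
      N↔m*k = ↔-trans orbitDecomposition
                (↔-trans (↔-sym enum ×-↔ proj₂ Reps-finite) (↔-sym Fin.*↔×))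

  module _ (enum : Fin m ↔ G) {X : Set b} {N : ℕ} (X↔N : X ↔ Fin N)
           {_◃_ : X → G → X} (isAction : IsRightAction _◃_)
           (free : ∀ x σ ρ → x ◃ σ ≡ x ◃ ρ → σ ≡ ρ) where

    open IsRightAction isAction
    open Inverse X↔N using (to; from; strictlyInverseʳ)

    private
      _◃ᴺ_ : Fin N → G → Fin N
      i ◃ᴺ σ = to (from i ◃ σ)

      ◃ᴺ-isAction : IsRightAction _◃ᴺ_
      ◃ᴺ-isAction = record
        { ◃-∙ = λ i σ ρ → cong to (trans (◃-∙ (from i) σ ρ)
                                          (cong (_◃ ρ) (sym (strictlyInverseʳ _))))
        ; ◃-ε = λ i → trans (cong to (◃-ε (from i))) (Inverse.strictlyInverseˡ X↔N i)
        }

    free⇒order∣card : m ∣ N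
    free⇒order∣card =
      free⇒order∣size enum ◃ᴺ-isAction λ i σ ρ eq → free (from i) σ ρ (↔-injective X↔N eq)

  module _ (enum : Fin m ↔ G) {L : ℕ} {_◃_ : Fin L → G → Fin L}
           (isAction : IsRightAction _◃_)
           (faithful : ∀ σ ρ → (∀ y → y ◃ σ ≡ y ◃ ρ) → σ ≡ ρ) where

    open IsRightAction isAction

    private
      ◃-injective : ∀ σ → Injective _≡_ _≡_ (_◃ σ)
      ◃-injective σ {y} {y′} eq = begin
        y                   ≡⟨ ◃-⁻¹ y σ ⟨
        (y ◃ σ) ◃ (σ ⁻¹)    ≡⟨ cong (_◃ (σ ⁻¹)) eq ⟩
        (y′ ◃ σ) ◃ (σ ⁻¹)   ≡⟨ ◃-⁻¹ y′ σ ⟩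
        y′                  ∎
        where open ≡-Reasoning

      _◃ᴸ_ : Lehmer L → G → Lehmer L
      c ◃ᴸ σ = encode (λ i → decode c i ◃ σ) (decode-injective c ∘′ ◃-injective σ)

      decode-◃ᴸ : ∀ c σ i → decode (c ◃ᴸ σ) i ≡ decode c i ◃ σ
      decode-◃ᴸ c σ = decode-encode _ _

      ◃ᴸ-isAction : IsRightAction _◃ᴸ_
      ◃ᴸ-isAction = record
        { ◃-∙ = λ c σ ρ → decode-extensional _ _ λ i → begin
            decode (c ◃ᴸ (σ ∙ ρ)) i       ≡⟨ decode-◃ᴸ c (σ ∙ ρ) i ⟩
            decode c i ◃ (σ ∙ ρ)          ≡⟨ ◃-∙ (decode c i) σ ρ ⟩
            (decode c i ◃ σ) ◃ ρ          ≡⟨ cong (_◃ ρ) (decode-◃ᴸ c σ i) ⟨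
            decode (c ◃ᴸ σ) i ◃ ρ         ≡⟨ decode-◃ᴸ (c ◃ᴸ σ) ρ i ⟨
            decode ((c ◃ᴸ σ) ◃ᴸ ρ) i      ∎
        ; ◃-ε = λ c → decode-extensional _ _ λ i → trans (decode-◃ᴸ c ε i) (◃-ε _)
        }
        where open ≡-Reasoning

      -- decode c is a permutation, so faithfulness on Fin L gives freeness on codes.
      ◃ᴸ-free : ∀ c σ ρ → c ◃ᴸ σ ≡ c ◃ᴸ ρ → σ ≡ ρ
      ◃ᴸ-free c σ ρ eq = faithful σ ρ λ y →
        let i , ci≡y = injective⇒surjective (decode c) (decode-injective c) ℕ.≤-refl y
        in subst (λ z → z ◃ σ ≡ z ◃ ρ) ci≡y (begin
             decode c i ◃ σ      ≡⟨ decode-◃ᴸ c σ i ⟨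
             decode (c ◃ᴸ σ) i   ≡⟨ cong (λ c′ → decode c′ i) eq ⟩
             decode (c ◃ᴸ ρ) i   ≡⟨ decode-◃ᴸ c ρ i ⟩
             decode c i ◃ ρ      ∎)
        where open ≡-Reasoning

    faithful⇒order∣! : m ∣ L !
    faithful⇒order∣! = free⇒order∣card enum (Lehmer↔Fin! L) ◃ᴸ-isAction ◃ᴸ-free

  module _ (enum : Fin m ↔ G) {L : ℕ} (label : G → Fin L)
           (label-∙ : ∀ σ τ ρ → label σ ≡ label τ → label (σ ∙ ρ) ≡ label (τ ∙ ρ))
           (label-faithful : ∀ ρ → (∀ σ → label (σ ∙ ρ) ≡ label σ) → ρ ≡ ε) where

    open Inverse enum using (to; from; strictlyInverseˡ)

    private
      Labelled : Fin L → Set a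
      Labelled y = ∃ λ σ → label σ ≡ y

      search : ∀ y → Dec (∃ λ i → label (to i) ≡ y)
      search y = Fin.any? (λ i → label (to i) Fin.≟ y)

      labelled? : ∀ y → Dec (Labelled y)
      labelled? y with search y
      ... | yes (i , eq) = yes (to i , eq)
      ... | no ¬hit = no λ (σ , eq) → ¬hit (from σ , trans (cong label (strictlyInverseˡ σ)) eq)

      move : (y : Fin L) → Dec (∃ λ i → label (to i) ≡ y) → G → Fin L
      move y (yes (i , _)) ρ = label (to i ∙ ρ)
      move y (no _) ρ = y

      _◃_ : Fin L → G → Fin L
      y ◃ ρ = move y (search y) ρ

      label-◃ : ∀ σ ρ → label σ ◃ ρ ≡ label (σ ∙ ρ)
      label-◃ σ ρ with search (label σ)
      ... | yes (i , eq) = label-∙ _ _ ρ eq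
      ... | no ¬hit = contradiction (from σ , cong label (strictlyInverseˡ σ)) ¬hit

      unlabelled-◃ : ∀ {y} → ¬ Labelled y → ∀ ρ → y ◃ ρ ≡ y
      unlabelled-◃ {y} ¬l ρ with search y
      ... | yes (i , eq) = contradiction (to i , eq) ¬l
      ... | no _ = refl

      ◃-isAction : IsRightAction _◃_
      ◃-isAction = record { ◃-∙ = ◃-∙ ; ◃-ε = ◃-ε }
        where
        ◃-∙ : ∀ y σ ρ → y ◃ (σ ∙ ρ) ≡ (y ◃ σ) ◃ ρ
        ◃-∙ y σ ρ with labelled? y
        ... | yes (τ , refl) = begin
          label τ ◃ (σ ∙ ρ)     ≡⟨ label-◃ τ (σ ∙ ρ) ⟩
          label (τ ∙ (σ ∙ ρ))   ≡⟨ cong label (assoc τ σ ρ) ⟨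
          label ((τ ∙ σ) ∙ ρ)   ≡⟨ label-◃ (τ ∙ σ) ρ ⟨
          label (τ ∙ σ) ◃ ρ     ≡⟨ cong (_◃ ρ) (label-◃ τ σ) ⟨
          (label τ ◃ σ) ◃ ρ     ∎
          where open ≡-Reasoning
        ... | no ¬l = trans (unlabelled-◃ ¬l (σ ∙ ρ))
                            (sym (trans (cong (_◃ ρ) (unlabelled-◃ ¬l σ)) (unlabelled-◃ ¬l ρ)))
        ◃-ε : ∀ y → y ◃ ε ≡ y
        ◃-ε y with labelled? y
        ... | yes (τ , refl) = trans (label-◃ τ ε) (cong label (identityʳ τ))
        ... | no ¬l = unlabelled-◃ ¬l ε

      ◃-faithful : ∀ σ ρ → (∀ y → y ◃ σ ≡ y ◃ ρ) → σ ≡ ρ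
      ◃-faithful σ ρ same = x∙y⁻¹≈ε⇒x≈y σ ρ (label-faithful (σ ∙ (ρ ⁻¹)) λ τ → begin
        label (τ ∙ (σ ∙ (ρ ⁻¹)))   ≡⟨ cong label (assoc τ σ (ρ ⁻¹)) ⟨
        label ((τ ∙ σ) ∙ (ρ ⁻¹))   ≡⟨ label-∙ _ _ (ρ ⁻¹) τσ≡τρ ⟩
        label ((τ ∙ ρ) ∙ (ρ ⁻¹))   ≡⟨ cong label (assoc τ ρ (ρ ⁻¹)) ⟩
        label (τ ∙ (ρ ∙ (ρ ⁻¹)))   ≡⟨ cong (λ z → label (τ ∙ z)) (inverseʳ ρ) ⟩
        label (τ ∙ ε)              ≡⟨ cong label (identityʳ τ) ⟩
        label τ                    ∎)
        where
        open ≡-Reasoning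
        τσ≡τρ : ∀ {τ} → label (τ ∙ σ) ≡ label (τ ∙ ρ)
        τσ≡τρ {τ} = trans (sym (label-◃ τ σ)) (trans (same (label τ)) (label-◃ τ ρ))

    faithfulLabelling⇒order∣! : m ∣ L !
    faithfulLabelling⇒order∣! = faithful⇒order∣! enum ◃-isAction ◃-faithful

module CategoryProperties {o ℓ : Level} (C : Category o ℓ) where

  open Category C
  open CatNotions C

  ∘-assoc : ∀ {W X Y Z} {f : Hom W X} {g : Hom X Y} {h : Hom Y Z} →
            (h ∘ g) ∘ f ≡ h ∘ (g ∘ f)
  ∘-assoc {f = f} {g} {h} = assoc f g h

  pullʳ : ∀ {W X Y Z} {a : Hom Y Z} {b : Hom X Y} {c : Hom W X} {d : Hom W Y} →
          b ∘ c ≡ d → (a ∘ b) ∘ c ≡ a ∘ d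
  pullʳ {a = a} bc≡d = trans ∘-assoc (cong (a ∘_) bc≡d)

  pullˡ : ∀ {W X Y Z} {a : Hom Y Z} {b : Hom X Y} {c : Hom W X} {d : Hom X Z} →
          a ∘ b ≡ d → a ∘ (b ∘ c) ≡ d ∘ c
  pullˡ {c = c} ab≡d = trans (sym ∘-assoc) (cong (_∘ c) ab≡d)

  reassoc : ∀ {W X Y Z} {a : Hom Y Z} {b : Hom X Y} {x y : Hom W X} →
            (a ∘ b) ∘ x ≡ (a ∘ b) ∘ y → a ∘ (b ∘ x) ≡ a ∘ (b ∘ y)
  reassoc ab∘x≡ab∘y = trans (sym ∘-assoc) (trans ab∘x≡ab∘y ∘-assoc)

  factor-cong : ∀ {X Y Z W} {i : Hom Y Z} {u : Hom Z W} {c : Hom Y W} {x y : Hom X Y} →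
                u ∘ i ≡ c → i ∘ x ≡ i ∘ y → c ∘ x ≡ c ∘ y
  factor-cong {i = i} {u} {c} {x} {y} u∘i≡c ix≡iy = begin
    c ∘ x         ≡⟨ cong (_∘ x) u∘i≡c ⟨
    (u ∘ i) ∘ x   ≡⟨ pullʳ ix≡iy ⟩
    u ∘ (i ∘ y)   ≡⟨ ∘-assoc ⟨
    (u ∘ i) ∘ y   ≡⟨ cong (_∘ y) u∘i≡c ⟩
    c ∘ y         ∎
    where open ≡-Reasoning

  HomOver-≡ : ∀ {A B E} {g : Hom E A} {f : Hom B A} {x y : HomOver g f} →
              proj₁ x ≡ proj₁ y → x ≡ y
  HomOver-≡ {x = h , p} {.h , q} refl = cong (h ,_) (Hom-isSet p q)

  inverse-unique : ∀ {A B} {f : Hom A B} {g g′ : Hom B A} → g ∘ f ≡ id → f ∘ g′ ≡ id → g ≡ g′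
  inverse-unique {f = f} {g} {g′} gf≡id fg′≡id = begin
    g              ≡⟨ identityʳ g ⟨
    g ∘ id         ≡⟨ cong (g ∘_) fg′≡id ⟨
    g ∘ (f ∘ g′)   ≡⟨ ∘-assoc ⟨
    (g ∘ f) ∘ g′   ≡⟨ cong (_∘ g′) gf≡id ⟩
    id ∘ g′        ≡⟨ identityˡ g′ ⟩
    g′             ∎
    where open ≡-Reasoning

  IsIso-irrelevant : ∀ {A B} {f : Hom A B} (x y : IsIso f) → x ≡ y
  IsIso-irrelevant (g , gf , fg) (g′ , gf′ , fg′) with refl ← inverse-unique gf fg′ =
    cong₂ (λ l r → g , l , r) (Hom-isSet gf gf′) (Hom-isSet fg fg′)

  IsIso-∘ : ∀ {A B E} {f : Hom A B} {g : Hom B E} → IsIso g → IsIso f → IsIso (g ∘ f)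
  IsIso-∘ {f = f} {g} (g⁻ , g⁻g , gg⁻) (f⁻ , f⁻f , ff⁻) = f⁻ ∘ g⁻ , cancel f⁻f g⁻g , cancel gg⁻ ff⁻
    where
    cancel : ∀ {X Y Z} {a : Hom X Y} {a⁻ : Hom Y X} {b : Hom Y Z} {b⁻ : Hom Z Y} →
             a⁻ ∘ a ≡ id → b⁻ ∘ b ≡ id → (a⁻ ∘ b⁻) ∘ (b ∘ a) ≡ id
    cancel {a = a} {a⁻} {b} {b⁻} a⁻a b⁻b = begin
      (a⁻ ∘ b⁻) ∘ (b ∘ a)   ≡⟨ ∘-assoc ⟩
      a⁻ ∘ (b⁻ ∘ (b ∘ a))   ≡⟨ cong (a⁻ ∘_) ∘-assoc ⟨
      a⁻ ∘ ((b⁻ ∘ b) ∘ a)   ≡⟨ cong (λ z → a⁻ ∘ (z ∘ a)) b⁻b ⟩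
      a⁻ ∘ (id ∘ a)         ≡⟨ cong (a⁻ ∘_) (identityˡ a) ⟩
      a⁻ ∘ a                ≡⟨ a⁻a ⟩
      id                    ∎
      where open ≡-Reasoning

  IsIso-inverse : ∀ {A B} {f : Hom A B} ((f⁻ , _) : IsIso f) → IsIso f⁻
  IsIso-inverse {f = f} (_ , f⁻f , ff⁻) = f , ff⁻ , f⁻f

  iso-cancelˡ : ∀ {A B E} {f : Hom B E} {x y : Hom A B} → IsIso f → f ∘ x ≡ f ∘ y → x ≡ y
  iso-cancelˡ {f = f} {x} {y} (f⁻ , f⁻f , _) fx≡fy = begin
    x               ≡⟨ identityˡ x ⟨
    id ∘ x          ≡⟨ cong (_∘ x) f⁻f ⟨
    (f⁻ ∘ f) ∘ x    ≡⟨ ∘-assoc ⟩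
    f⁻ ∘ (f ∘ x)    ≡⟨ cong (f⁻ ∘_) fx≡fy ⟩
    f⁻ ∘ (f ∘ y)    ≡⟨ ∘-assoc ⟨
    (f⁻ ∘ f) ∘ y    ≡⟨ cong (_∘ y) f⁻f ⟩
    id ∘ y          ≡⟨ identityˡ y ⟩
    y               ∎
    where open ≡-Reasoning

  pullback-jointlyMonic : ∀ {A B E P X} {f : Hom B A} {g : Hom E A} {p : Hom P B} {q : Hom P E} →
                          IsPullback f g p q → (x y : Hom X P) →
                          p ∘ x ≡ p ∘ y → q ∘ x ≡ q ∘ y → x ≡ y
  pullback-jointlyMonic {f = f} {g} {p} {q} pb x y px≡py qx≡qy =
    trans (factor-unique x refl refl) (sym (factor-unique y (sym px≡py) (sym qx≡qy)))
    where
    open IsPullback pb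
    commutes : f ∘ (p ∘ x) ≡ g ∘ (q ∘ x)
    commutes = trans (sym ∘-assoc) (trans (cong (_∘ x) commute) ∘-assoc)
    factor-unique : ∀ z → p ∘ z ≡ p ∘ x → q ∘ z ≡ q ∘ x →
                    z ≡ proj₁ (universal (p ∘ x) (q ∘ x) commutes)
    factor-unique = proj₂ (proj₂ (universal (p ∘ x) (q ∘ x) commutes))

module _ {o ℓ d s : Level} {C : Category o ℓ} (S : GaloisSetting d s C) where

  open Category C
  open CatNotions C
  open CategoryProperties C
  open GaloisSetting S
  open GaloisNotions S

  Σidx↣Fin : ∀ {U A} (a : D A) (f : Hom U A) → Σidx U ↣ Fin (deg a f)
  Σidx↣Fin a f = mk↣ {to = λ k → Fin.inject≤ (Any.index (complete k)) length≤deg} λ {k} {k′} eq →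
    let same-index = Fin.inject≤-injective length≤deg length≤deg _ _ eq
    in trans (Any.lookup-index (complete k))
             (trans (cong (lookup ks) same-index) (sym (Any.lookup-index (complete k′))))
    where
    ks = proj₁ (G4-II a f)
    complete = proj₁ (proj₂ (proj₂ (G4-II a f)))
    length≤deg : length ks ≤ deg a f
    length≤deg = subst (length ks ≤_) (sym (proj₂ (proj₂ (proj₂ (G4-II a f)))))
                       (length≤sum _ (λ k → deg-pos a (f ∘ Σarr k)) ks)

  Σidx-inhabited : ∀ {U A} (a : D A) (f : Hom U A) → Σidx U
  Σidx-inhabited a f with G4-II a f
  ... | k ∷ _ , _ = k
  ... | [] , _ , _ , deg≡0 = contradiction (subst (0 <_) deg≡0 (deg-pos a f)) (ℕ.<-irrefl refl)

  section-unique : ∀ {U X} → D U → D X → {r : Hom X U} {t t′ : Hom U X} →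
                   r ∘ t ≡ id → r ∘ t′ ≡ id → t ≡ t′
  section-unique {U} U∈D X∈D {r} {t} {t′} rt≡id rt′≡id =
    iso-cancelˡ r-iso (trans rt≡id (sym rt′≡id))
    where
    t-monic : ∀ {Y} → D Y → (x y : Hom Y U) → t ∘ x ≡ t ∘ y → x ≡ y
    t-monic _ x y tx≡ty = begin
      x               ≡⟨ identityˡ x ⟨
      id ∘ x          ≡⟨ cong (_∘ x) rt≡id ⟨
      (r ∘ t) ∘ x     ≡⟨ ∘-assoc ⟩
      r ∘ (t ∘ x)     ≡⟨ cong (r ∘_) tx≡ty ⟩
      r ∘ (t ∘ y)     ≡⟨ ∘-assoc ⟨
      (r ∘ t) ∘ y     ≡⟨ cong (_∘ y) rt≡id ⟩
      id ∘ y          ≡⟨ identityˡ y ⟩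
      y               ∎
      where open ≡-Reasoning
    r-iso : IsIso r
    r-iso = let t⁻ , t⁻t , tt⁻ = G2-III U∈D X∈D t t-monic
                r≡t⁻ = inverse-unique rt≡id tt⁻
            in t , trans (cong (t ∘_) r≡t⁻) tt⁻ , rt≡id

  -- A lift of u along k is a section of the pulled-back arrow q : P → U; two sections through
  -- the same Σ-component of P coincide, and Σ(P) has at most deg q = deg k elements.
  lifts↣Fin : ∀ {U K A} (a : D A) → D U → D K → (u : Hom U A) (k : Hom K A) →
              HomOver u k ↣ Fin (deg a k)
  lifts↣Fin {U} a U∈D K∈D u k =
    subst (λ n → HomOver u k ↣ Fin n) (sym deg-k≡deg-q)
          (↣-trans (mk↣ component-injective) (Σidx↣Fin U∈D q))
    where
    open Pullback (G1 a K∈D U∈D k u)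
    open IsPullback isPullback

    deg-k≡deg-q : deg a k ≡ deg U∈D q
    deg-k≡deg-q = proj₁ (G4-III a K∈D U∈D k u p q isPullback)

    lift-commutes : (w : HomOver u k) → k ∘ proj₁ w ≡ u ∘ id
    lift-commutes (w , u≡kw) = trans (sym u≡kw) (sym (identityʳ u))

    section : HomOver u k → Hom U P
    section w = proj₁ (universal (proj₁ w) id (lift-commutes w))

    p∘section : ∀ w → p ∘ section w ≡ proj₁ w
    p∘section w = proj₁ (proj₁ (proj₂ (universal (proj₁ w) id (lift-commutes w))))

    q∘section : ∀ w → q ∘ section w ≡ id
    q∘section w = proj₂ (proj₁ (proj₂ (universal (proj₁ w) id (lift-commutes w))))

    component : HomOver u k → Σidx P
    component w = proj₁ (G3 U∈D (section w))

    factor : ∀ w → HomOver (section w) (Σarr (component w))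
    factor w = proj₁ (proj₂ (G3 U∈D (section w)))

    same-component : ∀ κ {w w′} → HomOver (section w) (Σarr κ) → HomOver (section w′) (Σarr κ) →
                     section w ≡ section w′
    same-component κ {w} {w′} (t , s≡ιt) (t′ , s′≡ιt′) =
      trans s≡ιt (trans (cong (Σarr κ ∘_) t≡t′) (sym s′≡ιt′))
      where
      splits : ∀ {w t} → section w ≡ Σarr κ ∘ t → (q ∘ Σarr κ) ∘ t ≡ id
      splits {w} s≡ιt = trans ∘-assoc (trans (cong (q ∘_) (sym s≡ιt)) (q∘section w))
      t≡t′ : t ≡ t′
      t≡t′ = section-unique U∈D (Σdom-D κ) (splits s≡ιt) (splits s′≡ιt′)

    component-injective : Injective _≡_ _≡_ component
    component-injective {w} {w′} eq = HomOver-≡ (begin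
      proj₁ w          ≡⟨ p∘section w ⟨
      p ∘ section w    ≡⟨ cong (p ∘_) (same-component (component w) (factor w) factor′) ⟩
      p ∘ section w′   ≡⟨ p∘section w′ ⟩
      proj₁ w′         ∎)
      where
      open ≡-Reasoning
      factor′ : HomOver (section w′) (Σarr (component w))
      factor′ = subst (λ κ → HomOver (section w′) (Σarr κ)) (sym eq) (factor w′)

  module AutGroup {A : Obj} (c : Cover A) where

    open Cover c

    aut : Aut c → Hom dom dom
    aut σ = proj₁ (proj₁ σ)

    aut-over : (σ : Aut c) → arr ≡ arr ∘ aut σ
    aut-over σ = proj₂ (proj₁ σ)

    Aut-≡ : {σ ρ : Aut c} → aut σ ≡ aut ρ → σ ≡ ρ
    Aut-≡ {h , i} {h′ , i′} eq with refl ← HomOver-≡ {x = h} {y = h′} eq =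
      cong (h ,_) (IsIso-irrelevant i i′)

    _∙_ : Op₂ (Aut c)
    σ ∙ ρ = (aut σ ∘ aut ρ , trans (aut-over ρ) (trans (cong (_∘ aut ρ) (aut-over σ)) ∘-assoc))
          , IsIso-∘ (proj₂ σ) (proj₂ ρ)

    ε : Aut c
    ε = (id , sym (identityʳ arr)) , id , identityˡ id , identityˡ id

    _⁻¹ : Op₁ (Aut c)
    σ ⁻¹ = (σ⁻ , over) , aut σ , σσ⁻ , σ⁻σ
      where
      σ⁻ = proj₁ (proj₂ σ)
      σ⁻σ = proj₁ (proj₂ (proj₂ σ))
      σσ⁻ = proj₂ (proj₂ (proj₂ σ))
      over : arr ≡ arr ∘ σ⁻
      over = begin
        arr                  ≡⟨ identityʳ arr ⟨
        arr ∘ id             ≡⟨ cong (arr ∘_) σσ⁻ ⟨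
        arr ∘ (aut σ ∘ σ⁻)   ≡⟨ ∘-assoc ⟨
        (arr ∘ aut σ) ∘ σ⁻   ≡⟨ cong (_∘ σ⁻) (aut-over σ) ⟨
        arr ∘ σ⁻             ∎
        where open ≡-Reasoning

    isGroup : IsGroup _≡_ _∙_ ε _⁻¹
    isGroup = record
      { isMonoid = record
        { isSemigroup = record
          { isMagma = record { isEquivalence = isEquivalence ; ∙-cong = cong₂ _∙_ }
          ; assoc = λ _ _ _ → Aut-≡ ∘-assoc
          }
        ; identity = (λ _ → Aut-≡ (identityˡ _)) , (λ _ → Aut-≡ (identityʳ _))
        }
      ; inverse = (λ σ → Aut-≡ (proj₁ (proj₂ (proj₂ σ)))) , (λ σ → Aut-≡ (proj₂ (proj₂ (proj₂ σ))))
      ; ⁻¹-cong = cong _⁻¹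
      }

    group : Group _ _
    group = record { isGroup = isGroup }

  module _ {A : Obj} (c : Cover A) (gal : Galois c) where

    open Cover c
    open AutGroup c

    lifts-transitive : ∀ {U} → D U → {u : Hom U A} (w₀ w : HomOver u arr) →
                       ∃ λ σ → proj₁ w ≡ aut σ ∘ proj₁ w₀
    lifts-transitive U∈D {u} (w₀ , u≡w₀) w =
      let i , hit = injective⇒surjective index index-injective ℕ.≤-refl (Injection.to lifts↣deg w)
      in Inverse.to gal i , cong proj₁ (sym (Injection.injective lifts↣deg hit))
      where
      lifts↣deg : HomOver u arr ↣ Fin (degC c)
      lifts↣deg = lifts↣Fin codD U∈D domD u arr
      translate : Aut c → HomOver u arr
      translate σ = aut σ ∘ w₀ , trans u≡w₀ (trans (cong (_∘ w₀) (aut-over σ)) ∘-assoc)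
      index : Fin (degC c) → Fin (degC c)
      index i = Injection.to lifts↣deg (translate (Inverse.to gal i))
      index-injective : Injective _≡_ _≡_ index
      index-injective eq = ↔-injective gal (Aut-≡ (G2-II U∈D domD w₀ domD _ _
                             (cong proj₁ (Injection.injective lifts↣deg eq))))

    endomorphism⇒automorphism : (e : HomOver arr arr) → ∃ λ σ → proj₁ e ≡ aut σ
    endomorphism⇒automorphism e =
      let σ , e≡σ = lifts-transitive domD (id , sym (identityʳ arr)) e
      in σ , trans e≡σ (identityʳ (aut σ))

  module _ (g5 : G5) {A E B : Obj} (A∈D : D A) (E∈D : D E) (B∈D : D B)
           (f : Hom B A) (g : Hom E A) where

    record JointImage {n : ℕ} (H : Fin n → HomOver g f) : Set (o ⊔ ℓ ⊔ d) where
      field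
        {K}          : Obj
        K∈D          : D K
        v            : Hom E K
        k            : Hom K A
        k∘v          : k ∘ v ≡ g
        proj         : Fin n → Hom K B
        f∘proj       : ∀ i → f ∘ proj i ≡ k
        proj∘v       : ∀ i → proj i ∘ v ≡ proj₁ (H i)
        jointlyMonic : ∀ {X} (x y : Hom X K) → k ∘ x ≡ k ∘ y →
                       (∀ i → proj i ∘ x ≡ proj i ∘ y) → x ≡ y

    -- Pull back along f once per lift, keeping only the Σ-component through which E factors.
    jointImage : ∀ {n} (H : Fin n → HomOver g f) → JointImage H
    jointImage {zero} H = record
      { K∈D = A∈D ; v = g ; k = id ; k∘v = identityˡ g
      ; proj = λ () ; f∘proj = λ () ; proj∘v = λ ()
      ; jointlyMonic = λ x y idx≡idy _ → trans (sym (identityˡ x)) (trans idx≡idy (identityˡ y))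
      }
    jointImage {suc n} H = record
      { K∈D = Σdom-D κ ; v = t ; k = J.k ∘ π ; k∘v = trans (pullʳ π∘t) J.k∘v
      ; proj = project ; f∘proj = f∘project ; proj∘v = project∘t ; jointlyMonic = jointlyMonic
      }
      where
      module J = JointImage (jointImage (λ i → H (suc i)))
      open Pullback (G1 A∈D J.K∈D B∈D J.k f)
      open IsPullback isPullback

      commutes : J.k ∘ J.v ≡ f ∘ proj₁ (H zero)
      commutes = trans J.k∘v (proj₂ (H zero))

      paired : Hom E P
      paired = proj₁ (universal J.v (proj₁ (H zero)) commutes)

      p∘paired : p ∘ paired ≡ J.v
      p∘paired = proj₁ (proj₁ (proj₂ (universal J.v (proj₁ (H zero)) commutes)))

      q∘paired : q ∘ paired ≡ proj₁ (H zero)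
      q∘paired = proj₂ (proj₁ (proj₂ (universal J.v (proj₁ (H zero)) commutes)))

      κ : Σidx P
      κ = proj₁ (G3 E∈D paired)

      t : Hom E (Σdom κ)
      t = proj₁ (proj₁ (proj₂ (G3 E∈D paired)))

      ι∘t : Σarr κ ∘ t ≡ paired
      ι∘t = sym (proj₂ (proj₁ (proj₂ (G3 E∈D paired))))

      π : Hom (Σdom κ) J.K
      π = p ∘ Σarr κ

      π∘t : π ∘ t ≡ J.v
      π∘t = trans (pullʳ ι∘t) p∘paired

      project : Fin (suc n) → Hom (Σdom κ) B
      project zero = q ∘ Σarr κ
      project (suc i) = J.proj i ∘ π

      f∘project : ∀ i → f ∘ project i ≡ J.k ∘ π
      f∘project zero = trans (pullˡ (sym commute)) ∘-assoc
      f∘project (suc i) = pullˡ (J.f∘proj i)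

      project∘t : ∀ i → project i ∘ t ≡ proj₁ (H i)
      project∘t zero = trans (pullʳ ι∘t) q∘paired
      project∘t (suc i) = trans (pullʳ π∘t) (J.proj∘v i)

      jointlyMonic : ∀ {X} (x y : Hom X (Σdom κ)) → (J.k ∘ π) ∘ x ≡ (J.k ∘ π) ∘ y →
                     (∀ i → project i ∘ x ≡ project i ∘ y) → x ≡ y
      jointlyMonic x y kx≡ky project-≡ =
        g5 κ x y (pullback-jointlyMonic isPullback _ _ (reassoc πx≡πy) (reassoc (project-≡ zero)))
        where
        πx≡πy : π ∘ x ≡ π ∘ y
        πx≡πy = J.jointlyMonic (π ∘ x) (π ∘ y) (reassoc kx≡ky) (λ i → reassoc (project-≡ (suc i)))

  module _ (g5 : G5) {A : Obj} {fc gc : Cover A} (closure : IsGaloisClosure fc gc) where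

    open AutGroup gc
    open IsGroup isGroup using (inverseʳ)
    open GroupProperties group using (∙-cancelʳ; identityʳ-unique)
    open Cover gc using () renaming (dom to E; domD to E∈D; codD to A∈D; arr to g)
    open Cover fc using () renaming (dom to B; domD to B∈D; arr to f)

    private
      gal : Galois gc
      gal = proj₁ closure

      f⊑g : fc ⊑ gc
      f⊑g = proj₁ (proj₂ closure)

      minimal : ∀ h → Galois h → fc ⊑ h → h ⊑ gc → gc ⊑ h
      minimal = proj₂ (proj₂ closure)

      h₀ : Hom E B
      h₀ = proj₁ f⊑g

      lift : Aut gc → HomOver g f
      lift σ = h₀ ∘ aut σ , trans (aut-over σ) (trans (cong (_∘ aut σ) (proj₂ f⊑g)) ∘-assoc)

      open JointImage (jointImage g5 A∈D E∈D B∈D f g (λ i → lift (Inverse.to gal i)))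

      kc : Cover A
      kc = cover K∈D A∈D k

      module Autᴷ = AutGroup kc

      Π : Aut gc → Hom K B
      Π σ = proj (Inverse.from gal σ)

      Π∘v : ∀ σ → Π σ ∘ v ≡ h₀ ∘ aut σ
      Π∘v σ = trans (proj∘v _) (cong (λ τ → h₀ ∘ aut τ) (Inverse.strictlyInverseˡ gal σ))

      Π-jointlyMonic : ∀ {X} (x y : Hom X K) → (∀ σ → Π σ ∘ x ≡ Π σ ∘ y) → x ≡ y
      Π-jointlyMonic x y Π-≡ = jointlyMonic x y k-≡ λ i →
        subst (λ i′ → proj i′ ∘ x ≡ proj i′ ∘ y) (Inverse.strictlyInverseʳ gal i)
              (Π-≡ (Inverse.to gal i))
        where
        k-≡ : k ∘ x ≡ k ∘ y
        k-≡ = factor-cong (f∘proj (Inverse.from gal ε)) (Π-≡ ε)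

      v-epic : ∀ {X} → D X → (x y : Hom K X) → x ∘ v ≡ y ∘ v → x ≡ y
      v-epic = G2-II E∈D K∈D v

      -- Pushing v out along itself and v ∘ τ: both coprojections are monic, since every
      -- projection Π σ factors through them, so they are isomorphisms of D.
      descend : (τ : Aut gc) → Σ[ β ∈ Aut kc ] (Autᴷ.aut β ∘ v ≡ v ∘ aut τ)
      descend τ with Q , Q∈D , i , j , i∘v≡j∘vτ , universal ← G2-I E∈D K∈D K∈D v (v ∘ aut τ) =
        ((j⁻ ∘ i , k-over) , IsIso-∘ (IsIso-inverse j-iso) i-iso) , β∘v
        where
        cocone : ∀ σ → Π (σ ∙ τ) ∘ v ≡ Π σ ∘ (v ∘ aut τ)
        cocone σ = trans (Π∘v (σ ∙ τ)) (trans (sym ∘-assoc) (sym (pullˡ (Π∘v σ))))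

        mediates : ∀ σ → ∃ λ u → u ∘ i ≡ Π (σ ∙ τ) × u ∘ j ≡ Π σ
        mediates σ = let u , factors , _ = universal B∈D (Π (σ ∙ τ)) (Π σ) (cocone σ) in u , factors

        i-monic : ∀ {X} → D X → (x y : Hom X K) → i ∘ x ≡ i ∘ y → x ≡ y
        i-monic _ x y ix≡iy = Π-jointlyMonic x y λ σ →
          subst (λ ρ → Π ρ ∘ x ≡ Π ρ ∘ y) (∙-τ⁻¹-τ σ)
            (factor-cong (proj₁ (proj₂ (mediates (σ ∙ (τ ⁻¹))))) ix≡iy)
          where
          ∙-τ⁻¹-τ : ∀ σ → (σ ∙ (τ ⁻¹)) ∙ τ ≡ σ
          ∙-τ⁻¹-τ σ = Aut-≡ (trans (pullʳ (proj₁ (proj₂ (proj₂ τ)))) (identityʳ (aut σ)))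

        j-monic : ∀ {X} → D X → (x y : Hom X K) → j ∘ x ≡ j ∘ y → x ≡ y
        j-monic _ x y jx≡jy = Π-jointlyMonic x y λ σ →
          factor-cong (proj₂ (proj₂ (mediates σ))) jx≡jy

        i-iso : IsIso i
        i-iso = G2-III K∈D Q∈D i i-monic

        j-iso : IsIso j
        j-iso = G2-III K∈D Q∈D j j-monic

        j⁻ : Hom Q K
        j⁻ = proj₁ j-iso

        β∘v : (j⁻ ∘ i) ∘ v ≡ v ∘ aut τ
        β∘v = trans (pullʳ i∘v≡j∘vτ) (trans (sym ∘-assoc)
                (trans (cong (_∘ (v ∘ aut τ)) (proj₁ (proj₂ j-iso))) (identityˡ _)))

        k-over : k ≡ k ∘ (j⁻ ∘ i)
        k-over = v-epic A∈D _ _ (begin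
          k ∘ v                 ≡⟨ k∘v ⟩
          g                     ≡⟨ aut-over τ ⟩
          g ∘ aut τ             ≡⟨ cong (_∘ aut τ) k∘v ⟨
          (k ∘ v) ∘ aut τ       ≡⟨ ∘-assoc ⟩
          k ∘ (v ∘ aut τ)       ≡⟨ cong (k ∘_) β∘v ⟨
          k ∘ ((j⁻ ∘ i) ∘ v)    ≡⟨ ∘-assoc ⟨
          (k ∘ (j⁻ ∘ i)) ∘ v    ∎)
          where open ≡-Reasoning

      translate : (w : HomOver g k) → ∃ λ τ → proj₁ w ≡ v ∘ aut τ
      translate (w , g≡kw) = τ , sym (G2-II (Σdom-D κ) E∈D e₂ K∈D (v ∘ aut τ) w vτe₂≡we₂)
        where
        open Pullback (G1 K∈D E∈D E∈D v w)
        open IsPullback isPullback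
        κ : Σidx P
        κ = Σidx-inhabited E∈D q
        e₁ e₂ : Hom (Σdom κ) E
        e₁ = p ∘ Σarr κ
        e₂ = q ∘ Σarr κ
        v∘e₁≡w∘e₂ : v ∘ e₁ ≡ w ∘ e₂
        v∘e₁≡w∘e₂ = trans (sym ∘-assoc) (trans (cong (_∘ Σarr κ) commute) ∘-assoc)
        g∘e₂≡g∘e₁ : g ∘ e₂ ≡ g ∘ e₁
        g∘e₂≡g∘e₁ = begin
          g ∘ e₂          ≡⟨ cong (_∘ e₂) g≡kw ⟩
          (k ∘ w) ∘ e₂    ≡⟨ ∘-assoc ⟩
          k ∘ (w ∘ e₂)    ≡⟨ pullʳ v∘e₁≡w∘e₂ ⟨
          (k ∘ v) ∘ e₁    ≡⟨ cong (_∘ e₁) k∘v ⟩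
          g ∘ e₁          ∎
          where open ≡-Reasoning
        transitive : ∃ λ τ → e₁ ≡ aut τ ∘ e₂
        transitive = lifts-transitive gc gal (Σdom-D κ) (e₂ , refl) (e₁ , g∘e₂≡g∘e₁)
        τ : Aut gc
        τ = proj₁ transitive
        vτe₂≡we₂ : (v ∘ aut τ) ∘ e₂ ≡ w ∘ e₂
        vτe₂≡we₂ = trans (pullʳ (sym (proj₂ transitive))) v∘e₁≡w∘e₂

      Aut↔lifts : Aut kc ↔ HomOver g k
      Aut↔lifts = mk↔ₛ′ restrict extend restrict∘extend extend∘restrict
        where
        restrict : Aut kc → HomOver g k
        restrict β =
          Autᴷ.aut β ∘ v , trans (sym k∘v) (trans (cong (_∘ v) (Autᴷ.aut-over β)) ∘-assoc)
        extend : HomOver g k → Aut kc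
        extend w = proj₁ (descend (proj₁ (translate w)))
        extend∘v : ∀ w → Autᴷ.aut (extend w) ∘ v ≡ proj₁ w
        extend∘v w = trans (proj₂ (descend (proj₁ (translate w)))) (sym (proj₂ (translate w)))
        restrict∘extend : ∀ w → restrict (extend w) ≡ w
        restrict∘extend w = HomOver-≡ (extend∘v w)
        extend∘restrict : ∀ β → extend (restrict β) ≡ β
        extend∘restrict β = Autᴷ.Aut-≡ (v-epic K∈D (Autᴷ.aut (extend (restrict β))) (Autᴷ.aut β)
                                                   (extend∘v (restrict β)))

      -- τ ↦ v ∘ τ maps Aut gc onto the lifts of g along k, and its fibres embed in the
      -- lifts of v along itself; since deg g = deg k · deg v, both bounds are attained.
      lifts↔deg : HomOver g k ↔ Fin (deg A∈D k)
      lifts↔deg = mk↔ₛ′ (Injection.to lifts↣k) (λ y → restriction (proj₁ (hit y)))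
                        (λ y → proj₂ (hit y))
                        (λ w → Injection.injective lifts↣k (proj₂ (hit (Injection.to lifts↣k w))))
        where
        lifts↣k : HomOver g k ↣ Fin (deg A∈D k)
        lifts↣k = lifts↣Fin A∈D E∈D K∈D g k
        stabiliser↣v : HomOver v v ↣ Fin (deg K∈D v)
        stabiliser↣v = lifts↣Fin K∈D E∈D E∈D v v

        restriction : Aut gc → HomOver g k
        restriction τ = v ∘ aut τ , trans (aut-over τ) (trans (cong (_∘ aut τ) (sym k∘v)) ∘-assoc)

        φ : Aut gc → Fin (deg A∈D k)
        φ τ = Injection.to lifts↣k (restriction τ)

        offset : ∀ ρ τ → φ ρ ≡ φ τ → Fin (deg K∈D v)
        offset ρ τ φρ≡φτ = Injection.to stabiliser↣v (aut (τ ∙ (ρ ⁻¹)) , v-over)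
          where
          vρ≡vτ : v ∘ aut ρ ≡ v ∘ aut τ
          vρ≡vτ = cong proj₁ (Injection.injective lifts↣k φρ≡φτ)
          v-over : v ≡ v ∘ aut (τ ∙ (ρ ⁻¹))
          v-over = begin
            v                           ≡⟨ identityʳ v ⟨
            v ∘ id                      ≡⟨ cong (λ σ → v ∘ aut σ) (inverseʳ ρ) ⟨
            v ∘ (aut ρ ∘ aut (ρ ⁻¹))    ≡⟨ pullˡ vρ≡vτ ⟩
            (v ∘ aut τ) ∘ aut (ρ ⁻¹)    ≡⟨ ∘-assoc ⟩
            v ∘ aut (τ ∙ (ρ ⁻¹))        ∎
            where open ≡-Reasoning

        offset-injective : ∀ ρ {τ τ′} p p′ → offset ρ τ p ≡ offset ρ τ′ p′ → τ ≡ τ′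
        offset-injective ρ _ _ eq =
          ∙-cancelʳ (ρ ⁻¹) _ _ (Aut-≡ (cong proj₁ (Injection.injective stabiliser↣v eq)))

        deg-g≡deg-k*deg-v : degC gc ≡ deg A∈D k * deg K∈D v
        deg-g≡deg-k*deg-v = trans (cong (deg A∈D) (sym k∘v)) (G4-I A∈D K∈D v k)

        hit : ∀ y → ∃ λ τ → φ τ ≡ y
        hit = L₁*L₂≤card⇒surjective gal φ offset offset-injective
                (ℕ.≤-reflexive (sym deg-g≡deg-k*deg-v)) ε

      kc-Galois : Galois kc
      kc-Galois = ↔-sym (↔-trans Aut↔lifts lifts↔deg)

      g⊑kc : gc ⊑ kc
      g⊑kc = minimal kc kc-Galois (proj (Inverse.from gal ε) , sym (f∘proj _)) (v , sym k∘v)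

      -- v is split by g ⊑ kc, so an automorphism fixing v fixes E.
      stabiliser-trivial : ∀ σ → v ∘ aut σ ≡ v → σ ≡ ε
      stabiliser-trivial σ vσ≡v = identityʳ-unique ρ σ (Aut-≡ (begin
        aut ρ ∘ aut σ          ≡⟨ cong (_∘ aut σ) wv≡ρ ⟨
        (w ∘ v) ∘ aut σ        ≡⟨ pullʳ vσ≡v ⟩
        w ∘ v                  ≡⟨ wv≡ρ ⟩
        aut ρ                  ∎))
        where
        open ≡-Reasoning
        w : Hom K E
        w = proj₁ g⊑kc
        g-over : g ≡ g ∘ (w ∘ v)
        g-over = trans (sym k∘v) (trans (cong (_∘ v) (proj₂ g⊑kc)) ∘-assoc)
        ρ : Aut gc
        ρ = proj₁ (endomorphism⇒automorphism gc gal (w ∘ v , g-over))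
        wv≡ρ : w ∘ v ≡ aut ρ
        wv≡ρ = proj₂ (endomorphism⇒automorphism gc gal (w ∘ v , g-over))

    closure-degree∣! : degC gc ∣ (degC fc) !
    closure-degree∣! = faithfulLabelling⇒order∣! isGroup gal label label-∙ label-faithful
      where
      open ≡-Reasoning

      lifts↣f : HomOver g f ↣ Fin (degC fc)
      lifts↣f = lifts↣Fin (Cover.codD fc) E∈D B∈D g f

      label : Aut gc → Fin (degC fc)
      label σ = Injection.to lifts↣f (lift σ)

      label-injective : ∀ σ τ → label σ ≡ label τ → h₀ ∘ aut σ ≡ h₀ ∘ aut τ
      label-injective _ _ eq = cong proj₁ (Injection.injective lifts↣f eq)

      label-∙ : ∀ σ τ ρ → label σ ≡ label τ → label (σ ∙ ρ) ≡ label (τ ∙ ρ)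
      label-∙ σ τ ρ eq = cong (Injection.to lifts↣f) (HomOver-≡ (begin
        h₀ ∘ (aut σ ∘ aut ρ)   ≡⟨ ∘-assoc ⟨
        (h₀ ∘ aut σ) ∘ aut ρ   ≡⟨ cong (_∘ aut ρ) (label-injective σ τ eq) ⟩
        (h₀ ∘ aut τ) ∘ aut ρ   ≡⟨ ∘-assoc ⟩
        h₀ ∘ (aut τ ∘ aut ρ)   ∎))

      label-faithful : ∀ ρ → (∀ σ → label (σ ∙ ρ) ≡ label σ) → ρ ≡ ε
      label-faithful ρ fixed = stabiliser-trivial ρ (Π-jointlyMonic (v ∘ aut ρ) v λ σ → begin
        Π σ ∘ (v ∘ aut ρ)      ≡⟨ ∘-assoc ⟨
        (Π σ ∘ v) ∘ aut ρ      ≡⟨ cong (_∘ aut ρ) (Π∘v σ) ⟩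
        (h₀ ∘ aut σ) ∘ aut ρ   ≡⟨ ∘-assoc ⟩
        h₀ ∘ aut (σ ∙ ρ)       ≡⟨ label-injective (σ ∙ ρ) σ (fixed σ) ⟩
        h₀ ∘ aut σ             ≡⟨ Π∘v σ ⟨
        Π σ ∘ v                ∎)

theorem4p15 : ∀ {o ℓ d s : Level} {C : Category o ℓ} (S : GaloisSetting d s C) →
              GaloisNotions.G5 S →
              ∀ {A} (f g : GaloisNotions.Cover S A) →
              GaloisNotions.IsGaloisClosure S f g →
              GaloisNotions.degC S g ∣ (GaloisNotions.degC S f) !
theorem4p15 S g5 f g closure = closure-degree∣! S g5 {fc = f} {gc = g} closure
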